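{- For $m\ge 1$, let $C_m$ be the central bar state matrix of length $m$ (defined in the context). Set $C_0=\begin{bmatrix}1\end{bmatrix}$. Then $C_1=\begin{bmatrix}0&1\\1&0\end{bmatrix}$ and, for every $k\ge 2$, $$C_k=\begin{bmatrix}\begin{bmatrix}C_{k-2}&\mathbb{O}\\ \mathbb{O}&\mathbb{O}\end{bmatrix} & C_{k-1}\\ C_{k-1} & \mathbb{O}\end{bmatrix}.$$
   Context: Consider four mosaic tiles $T_1,T_2,T_3,T_4$, each a unit square whose four edges are labeled by letters a or b, with exactly one edge labeled b: in $T_1$ the left edge, in $T_2$ the top edge, in $T_3$ the bottom edge, in $T_4$ the right edge (all other edges labeled a). A bar mosaic of length $m$ is a horizontal row of $m$ unit squares each carrying one of these tiles; it is suitably adjacent if any two adjacent tiles give the same label to their common edge. Its $l$-state and $r$-state are the labels of its left and right boundary edges; its $b$-state ($t$-state) is the word of length $m$ in $\{\mathrm{a},\mathrm{b}\}$ formed by the labels of its bottom (top) edges read from right to left (so the first letter belongs to the rightmost tile). The $2^m$ words of length $m$ in $\{\mathrm{a},\mathrm{b}\}$ are ordered lexicographically with $\mathrm{a}<\mathrm{b}$; $\epsilon^m_i$ denotes the $i$th one. For states $s_r,s_b,s_t$ let $\mu_{\langle s_r,s_b,s_t\rangle}$ be the number of suitably adjacent bar mosaics with $l$-state a, $r$-state $s_r$, $b$-state $s_b$ and $t$-state $s_t$. The central bar state matrix $C_m$ is the $2^m\times 2^m$ matrix whose $(i,j)$-entry is $\mu_{\langle \mathrm{a},\epsilon^m_i,\epsilon^m_j\rangle}$.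 $\mathbb{O}$ denotes a zero matrix of the appropriate size. -}

module Defs where

open import Data.Nat using (ℕ; zero; suc; _+_; _^_)
open import Data.Nat.Properties using (+-identityʳ)
open import Data.Fin using (Fin; splitAt; cast)
import Data.Fin as Fin
open import Data.Sum using (inj₁; inj₂)
open import Data.Bool using (Bool; true; false; _∧_)
open import Data.List using (List; []; _∷_; map; concatMap; length; filterᵇ)
open import Data.Vec using (Vec; []; _∷_; head; last; reverse)
import Data.Vec as V
open import Relation.Binary.PropositionalEquality using (_≡_; refl; sym; cong)

data Label : Set where
  a b : Label

_==ᴸ_ : Label → Label → Bool
a ==ᴸ a = true
b ==ᴸ b = true
_ ==ᴸ _ = false

Word : ℕ → Set
Word = Vec Label

_==ᵂ_ : ∀ {m} → Word m → Word m → Bool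
[] ==ᵂ [] = true
(x ∷ xs) ==ᵂ (y ∷ ys) = (x ==ᴸ y) ∧ (xs ==ᵂ ys)

data Tile : Set where
  T₁ T₂ T₃ T₄ : Tile

allTiles : List Tile
allTiles = T₁ ∷ T₂ ∷ T₃ ∷ T₄ ∷ []

left right top bottom : Tile → Label
left T₁ = b
left _  = a
top T₂ = b
top _  = a
bottom T₃ = b
bottom _  = a
right T₄ = b
right _  = a

-- A bar mosaic of length m: its tiles listed from left to right
BarMosaic : ℕ → Set
BarMosaic = Vec Tile

allMosaics : (m : ℕ) → List (BarMosaic m)
allMosaics zero = [] ∷ []
allMosaics (suc m) = concatMap (λ t → map (t ∷_) (allMosaics m)) allTiles

suitablyAdjacent : ∀ {m} → BarMosaic m → Bool
suitablyAdjacent [] = true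
suitablyAdjacent (t ∷ []) = true
suitablyAdjacent (t ∷ (u ∷ ts)) = (right t ==ᴸ left u) ∧ suitablyAdjacent (u ∷ ts)

lState rState : ∀ {m} → BarMosaic (suc m) → Label
lState M = left (head M)
rState M = right (last M)

bState tState : ∀ {m} → BarMosaic m → Word m
bState M = reverse (V.map bottom M)
tState M = reverse (V.map top M)

pow2-split : (n : ℕ) → 2 ^ n + 2 ^ n ≡ 2 ^ suc n
pow2-split n = cong (2 ^ n +_) (sym (+-identityʳ (2 ^ n)))

-- ε m i : the i-th (0-indexed) word of length m in lexicographic order, a < b
ε : (m : ℕ) → Fin (2 ^ m) → Word m
ε zero _ = []
ε (suc m) i with splitAt (2 ^ m) (cast (sym (pow2-split m)) i)
... | inj₁ j = a ∷ ε m j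
... | inj₂ j = b ∷ ε m j

μ : ∀ {m} → Label → Word (suc m) → Word (suc m) → ℕ
μ {m} sr sb st = length (filterᵇ ok (allMosaics (suc m)))
  where
  ok : BarMosaic (suc m) → Bool
  ok M = suitablyAdjacent M ∧ (lState M ==ᴸ a) ∧ (rState M ==ᴸ sr)
         ∧ (bState M ==ᵂ sb) ∧ (tState M ==ᵂ st)

Mat : ℕ → Set
Mat n = Fin n → Fin n → ℕ

_≈ₘ_ : ∀ {n} → Mat n → Mat n → Set
A ≈ₘ B = ∀ i j → A i j ≡ B i j

𝕆 : ∀ {n} → Mat n
𝕆 _ _ = 0

castMat : ∀ {n n'} → n ≡ n' → Mat n → Mat n'
castMat e A i j = A (cast (sym e) i) (cast (sym e) j)

block : ∀ {n} → Mat n → Mat n → Mat n → Mat n → Mat (n + n)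
block {n} A B C D i j with splitAt n i | splitAt n j
... | inj₁ i' | inj₁ j' = A i' j'
... | inj₁ i' | inj₂ j' = B i' j'
... | inj₂ i' | inj₁ j' = C i' j'
... | inj₂ i' | inj₂ j' = D i' j'

block₂ : ∀ n → Mat (2 ^ n) → Mat (2 ^ n) → Mat (2 ^ n) → Mat (2 ^ n) → Mat (2 ^ suc n)
block₂ n A B C D = castMat (pow2-split n) (block A B C D)

C : (m : ℕ) → Mat (2 ^ m)
C zero _ _ = 1
C (suc m) i j = μ a (ε (suc m) i) (ε (suc m) j)

C₁-expected : Mat (2 ^ 1)
C₁-expected Fin.zero Fin.zero = 0
C₁-expected Fin.zero (Fin.suc _) = 1
C₁-expected (Fin.suc _) Fin.zero = 1
C₁-expected (Fin.suc _) (Fin.suc _) = 0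

-- Reading the words from the right peels off the rightmost tile first.  Its
-- right, bottom and top labels (the r-state and the first letters of the b- and
-- t-states) determine it uniquely, or rule out every tile, and its left label
-- becomes the r-state of the remaining bar.  Since ε splits the index range by
-- the first letter, this one-tile recursion is exactly the block recursion,
-- with the μ⟨b,·,·⟩ entries forming the top-left block.
module Submission where

open import Defs
open import Data.Bool using (Bool; true; false; _∧_; if_then_else_)
open import Data.Bool.Properties using (∧-identityʳ; ∧-assoc; ∧-commutativeMonoid)
open import Data.Fin using (splitAt; cast)
import Data.Fin as Fin
open import Data.List using (List; []; _∷_; _++_; map; concatMap; length; filterᵇ; lookup)
open import Data.List.Properties using (length-++; filter-++; map-cong)
open import Data.Nat using (ℕ; zero; suc; _+_; _^_)
open import Data.Nat.ListAction using (sum)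
open import Data.Nat.Properties using (+-identityʳ; +-0-commutativeMonoid)
open import Data.Product using (_×_; _,_)
open import Data.Sum using (inj₁; inj₂)
open import Data.Vec using (Vec; []; _∷_; _∷ʳ_; last; reverse)
import Data.Vec as Vec
open import Data.Vec.Properties using (map-∷ʳ; last-∷ʳ; foldl-∷ʳ)
open import Function using (_∘_)
open import Relation.Binary.PropositionalEquality
  using (_≡_; _≗_; refl; sym; trans; cong; module ≡-Reasoning)
open import Relation.Nullary.Decidable using (T?)

open import Algebra.Properties.CommutativeMonoid.Sum +-0-commutativeMonoid using (∑-comm)
open import Algebra.Solver.CommutativeMonoid ∧-commutativeMonoid using (solve; _⊕_; _⊜_)

private variable
  A B : Set

count : (A → Bool) → List A → ℕ
count p xs = length (filterᵇ p xs)

count-cong : {p q : A → Bool} → p ≗ q → count p ≗ count q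
count-cong p≗q []       = refl
count-cong {p = p} {q} p≗q (x ∷ xs) with p x | q x | p≗q x
... | true  | .true  | refl = cong suc (count-cong p≗q xs)
... | false | .false | refl = count-cong p≗q xs

count-false : count {A} (λ _ → false) ≗ λ _ → 0
count-false []       = refl
count-false (x ∷ xs) = count-false xs

count-∧ : ∀ c (q : A → Bool) xs → count (λ x → c ∧ q x) xs ≡ (if c then count q xs else 0)
count-∧ true  q xs = refl
count-∧ false q xs = count-false xs

count-++ : ∀ (p : A → Bool) xs ys → count p (xs ++ ys) ≡ count p xs + count p ys
count-++ p xs ys = trans (cong length (filter-++ (T? ∘ p) xs ys)) (length-++ (filterᵇ p xs))

count-map : ∀ (p : B → Bool) (f : A → B) xs → count p (map f xs) ≡ count (p ∘ f) xs
count-map p f []       = refl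
count-map p f (x ∷ xs) with p (f x)
... | true  = cong suc (count-map p f xs)
... | false = count-map p f xs

count-concatMap : ∀ (p : B → Bool) (f : A → List B) xs →
                  count p (concatMap f xs) ≡ sum (map (count p ∘ f) xs)
count-concatMap p f []       = refl
count-concatMap p f (x ∷ xs) =
  trans (count-++ p (f x) (concatMap f xs)) (cong (count p (f x) +_) (count-concatMap p f xs))

Σᵗ : (Tile → ℕ) → ℕ
Σᵗ f = sum (map f allTiles)

Σᵗ-cong : {f g : Tile → ℕ} → f ≗ g → Σᵗ f ≡ Σᵗ g
Σᵗ-cong f≗g = cong sum (map-cong f≗g allTiles)

Σᵗ-comm : (f : Tile → Tile → ℕ) → Σᵗ (λ u → Σᵗ (f u)) ≡ Σᵗ (λ t → Σᵗ (λ u → f u t))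
Σᵗ-comm f = ∑-comm (λ i j → f (lookup allTiles i) (lookup allTiles j))

count-allMosaics-∷ : ∀ n (p : BarMosaic (suc n) → Bool) →
                     count p (allMosaics (suc n)) ≡ Σᵗ (λ t → count (p ∘ (t ∷_)) (allMosaics n))
count-allMosaics-∷ n p =
  trans (count-concatMap p (λ t → map (t ∷_) (allMosaics n)) allTiles)
        (Σᵗ-cong (λ t → count-map p (t ∷_) (allMosaics n)))

count-allMosaics-∷ʳ : ∀ n (p : BarMosaic (suc n) → Bool) →
                      count p (allMosaics (suc n)) ≡ Σᵗ (λ t → count (p ∘ (_∷ʳ t)) (allMosaics n))
count-allMosaics-∷ʳ zero    p =
  trans (count-allMosaics-∷ zero p)
        (Σᵗ-cong λ t → count-cong {p = p ∘ (t ∷_)} {p ∘ (_∷ʳ t)} (λ { [] → refl }) (allMosaics zero))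
count-allMosaics-∷ʳ (suc n) p = begin
  count p (allMosaics (suc (suc n)))
    ≡⟨ count-allMosaics-∷ (suc n) p ⟩
  Σᵗ (λ u → count (p ∘ (u ∷_)) (allMosaics (suc n)))
    ≡⟨ Σᵗ-cong (λ u → count-allMosaics-∷ʳ n (p ∘ (u ∷_))) ⟩
  Σᵗ (λ u → Σᵗ (λ t → count (λ M → p (u ∷ (M ∷ʳ t))) (allMosaics n)))
    ≡⟨ Σᵗ-comm (λ u t → count (λ M → p (u ∷ (M ∷ʳ t))) (allMosaics n)) ⟩
  Σᵗ (λ t → Σᵗ (λ u → count (λ M → p (u ∷ (M ∷ʳ t))) (allMosaics n)))
    ≡⟨ Σᵗ-cong (λ t → sym (count-allMosaics-∷ n (p ∘ (_∷ʳ t)))) ⟩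
  Σᵗ (λ t → count (p ∘ (_∷ʳ t)) (allMosaics (suc n)))
    ∎
  where open ≡-Reasoning

reverse-∷ʳ : ∀ {n} x (xs : Vec A n) → reverse (xs ∷ʳ x) ≡ x ∷ reverse xs
reverse-∷ʳ {A = A} x xs = foldl-∷ʳ (Vec A) (λ rev y → y ∷ rev) [] x xs

reverse-map-∷ʳ : ∀ {n} (f : A → B) x (xs : Vec A n) →
                 reverse (Vec.map f (xs ∷ʳ x)) ≡ f x ∷ reverse (Vec.map f xs)
reverse-map-∷ʳ f x xs = trans (cong reverse (map-∷ʳ f x xs)) (reverse-∷ʳ (f x) (Vec.map f xs))

suitablyAdjacent-∷ʳ : ∀ {n} (M : BarMosaic (suc n)) t →
                      suitablyAdjacent (M ∷ʳ t) ≡ suitablyAdjacent M ∧ (right (last M) ==ᴸ left t)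
suitablyAdjacent-∷ʳ (u ∷ [])     t = ∧-identityʳ _
suitablyAdjacent-∷ʳ (u ∷ v ∷ M) t =
  trans (cong ((right u ==ᴸ left v) ∧_) (suitablyAdjacent-∷ʳ (v ∷ M) t))
        (sym (∧-assoc (right u ==ᴸ left v) (suitablyAdjacent (v ∷ M)) _))

-- The predicate filtered in the definition of μ, so μ sr sb st is definitionally a count.
counted : ∀ {m} → Label → Word (suc m) → Word (suc m) → BarMosaic (suc m) → Bool
counted sr sb st M = suitablyAdjacent M ∧ (lState M ==ᴸ a) ∧ (rState M ==ᴸ sr)
                     ∧ (bState M ==ᵂ sb) ∧ (tState M ==ᵂ st)

fits : Label → Label → Label → Tile → Bool
fits sr x y t = (right t ==ᴸ sr) ∧ (bottom t ==ᴸ x) ∧ (top t ==ᴸ y)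

counted-∷ʳ : ∀ {k} sr x y (sb st : Word (suc k)) (M : BarMosaic (suc k)) t →
             counted sr (x ∷ sb) (y ∷ st) (M ∷ʳ t) ≡ fits sr x y t ∧ counted (left t) sb st M
counted-∷ʳ sr x y sb st M@(u ∷ _) t
  rewrite suitablyAdjacent-∷ʳ M t | last-∷ʳ t M
        | reverse-map-∷ʳ bottom t M | reverse-map-∷ʳ top t M =
  solve 8 (λ s c l r bx bw ty tw →
             (s ⊕ c) ⊕ (l ⊕ (r ⊕ ((bx ⊕ bw) ⊕ (ty ⊕ tw))))
           ⊜ (r ⊕ (bx ⊕ ty)) ⊕ (s ⊕ (l ⊕ (c ⊕ (bw ⊕ tw)))))
        refl (suitablyAdjacent M) (right (last M) ==ᴸ left t) (left u ==ᴸ a) (right t ==ᴸ sr)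
        (bottom t ==ᴸ x) (bState M ==ᵂ sb) (top t ==ᴸ y) (tState M ==ᵂ st)

μ-∷ : ∀ {k} sr x y (sb st : Word (suc k)) →
      μ sr (x ∷ sb) (y ∷ st) ≡ Σᵗ (λ t → if fits sr x y t then μ (left t) sb st else 0)
μ-∷ {k} sr x y sb st =
  trans (count-allMosaics-∷ʳ (suc k) (counted sr (x ∷ sb) (y ∷ st)))
        (Σᵗ-cong λ t → trans (count-cong (λ M → counted-∷ʳ sr x y sb st M t) (allMosaics (suc k)))
                             (count-∧ (fits sr x y t) (counted (left t) sb st) (allMosaics (suc k))))

-- The only fitting tiles: T₁ for (a,a,a), T₂ for (a,a,b), T₃ for (a,b,a), T₄ for (b,a,a).
module _ {k : ℕ} (sb st : Word (suc k)) where

  μ-a-aa : μ a (a ∷ sb) (a ∷ st) ≡ μ b sb st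
  μ-a-aa = trans (μ-∷ a a a sb st) (+-identityʳ _)

  μ-a-ab : μ a (a ∷ sb) (b ∷ st) ≡ μ a sb st
  μ-a-ab = trans (μ-∷ a a b sb st) (+-identityʳ _)

  μ-a-ba : μ a (b ∷ sb) (a ∷ st) ≡ μ a sb st
  μ-a-ba = trans (μ-∷ a b a sb st) (+-identityʳ _)

  μ-a-bb : μ a (b ∷ sb) (b ∷ st) ≡ 0
  μ-a-bb = μ-∷ a b b sb st

  μ-b-aa : μ b (a ∷ sb) (a ∷ st) ≡ μ a sb st
  μ-b-aa = trans (μ-∷ b a a sb st) (+-identityʳ _)

  μ-b-ab : μ b (a ∷ sb) (b ∷ st) ≡ 0
  μ-b-ab = μ-∷ b a b sb st

  μ-b-b : ∀ y → μ b (b ∷ sb) (y ∷ st) ≡ 0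
  μ-b-b y = μ-∷ b b y sb st

μ-b-block : ∀ k i j → μ b (ε (suc k) i) (ε (suc k) j) ≡ block₂ k (C k) 𝕆 𝕆 𝕆 i j
μ-b-block k i j with splitAt (2 ^ k) (cast (sym (pow2-split k)) i)
                   | splitAt (2 ^ k) (cast (sym (pow2-split k)) j)
μ-b-block zero    i j | inj₁ _  | inj₁ _  = refl
μ-b-block zero    i j | inj₁ _  | inj₂ _  = refl
μ-b-block zero    i j | inj₂ _  | inj₁ _  = refl
μ-b-block zero    i j | inj₂ _  | inj₂ _  = refl
μ-b-block (suc k) i j | inj₁ i′ | inj₁ j′ = μ-b-aa (ε (suc k) i′) (ε (suc k) j′)
μ-b-block (suc k) i j | inj₁ i′ | inj₂ j′ = μ-b-ab (ε (suc k) i′) (ε (suc k) j′)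
μ-b-block (suc k) i j | inj₂ i′ | inj₁ j′ = μ-b-b (ε (suc k) i′) (ε (suc k) j′) a
μ-b-block (suc k) i j | inj₂ i′ | inj₂ j′ = μ-b-b (ε (suc k) i′) (ε (suc k) j′) b

C-block : ∀ k → C (suc (suc k)) ≈ₘ block₂ (suc k) (block₂ k (C k) 𝕆 𝕆 𝕆) (C (suc k)) (C (suc k)) 𝕆
C-block k i j with splitAt (2 ^ suc k) (cast (sym (pow2-split (suc k))) i)
                 | splitAt (2 ^ suc k) (cast (sym (pow2-split (suc k))) j)
... | inj₁ i′ | inj₁ j′ = trans (μ-a-aa (ε (suc k) i′) (ε (suc k) j′)) (μ-b-block k i′ j′)
... | inj₁ i′ | inj₂ j′ = μ-a-ab (ε (suc k) i′) (ε (suc k) j′)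
... | inj₂ i′ | inj₁ j′ = μ-a-ba (ε (suc k) i′) (ε (suc k) j′)
... | inj₂ i′ | inj₂ j′ = μ-a-bb (ε (suc k) i′) (ε (suc k) j′)

C₁ : C 1 ≈ₘ C₁-expected
C₁ Fin.zero             Fin.zero             = refl
C₁ Fin.zero             (Fin.suc Fin.zero)   = refl
C₁ (Fin.suc Fin.zero)   Fin.zero             = refl
C₁ (Fin.suc Fin.zero)   (Fin.suc Fin.zero)   = refl

lemma2 : (C 1 ≈ₘ C₁-expected)
    × (∀ (k : ℕ) → C (suc (suc k)) ≈ₘ block₂ (suc k) (block₂ k (C k) 𝕆 𝕆 𝕆) (C (suc k)) (C (suc k)) 𝕆)
lemma2 = C₁ , C-block
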